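{- Let $a,c$ be integers with $a\neq-3c^2$ and $a\neq -3c^2/4$. Let $E:\ y^2=x^3+ax-c^3-ac$ with $P_0=(c,0)$, and $\tilde E:\ \tilde y^2=\tilde x^3+\tilde a\tilde x-\tilde c^3-\tilde a\tilde c$ with $\tilde a=-4a-15c^2$, $\tilde c=-2c$. Let $\psi:E(\mathbb{Q})\to\tilde E(\mathbb{Q})$ be $\psi(x,y)=\left(\frac{x^2-xc+a+3c^2}{x-c},\ \frac{y(x^2-2xc-a-2c^2)}{(x-c)^2}\right)$ for $x\neq c,\infty$, with $\psi(P_0)=\psi(P_\infty)=\tilde P_\infty$, and let $\tilde\psi:\tilde E(\mathbb{Q})\to E(\mathbb{Q})$ be $\tilde\psi(\tilde x,\tilde y)=\left(\frac{\tilde x^2-\tilde x\tilde c+\tilde a+3\tilde c^2}{4(\tilde x-\tilde c)},\ \frac{\tilde y(\tilde x^2-2\tilde x\tilde c-\tilde a-2\tilde c^2)}{8(\tilde x-\tilde c)^2}\right)$ for $\tilde x\neq\tilde c,\infty$, with $\tilde\psi(\tilde c,0)=\tilde\psi(\tilde P_\infty)=P_\infty$. Then the index $[\ker\tilde\psi:(\ker\tilde\psi\cap\psi(E(\mathbb{Q})))]$ equals $1$ if and only if $E$ has a rational point $(x,0)$ of order $2$ different from $P_0$; otherwise this index equals $2$.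
   Context: $P_\infty,\tilde P_\infty$ are the points at infinity (neutral elements) of $E,\tilde E$; $\psi$ and $\tilde\psi$ are group homomorphisms of the groups of rational points. -}

module Defs where

open import Data.Nat using (ℕ)
open import Data.Fin using (Fin)
open import Data.Unit using (⊤)
open import Data.Integer as ℤ using (ℤ)
open import Data.Rational using (ℚ; _+_; _*_; _-_; -_; _÷_; 0ℚ; 1ℚ; ≢-nonZero)
import Data.Rational as Q
open import Data.Rational.Properties using (_≟_)
open import Data.Product using (Σ; _×_; ∃)
open import Relation.Nullary using (yes; no)
open import Relation.Binary.PropositionalEquality using (_≡_)

ι : ℤ → ℚ
ι z = z Q./ 1

2ℚ 3ℚ 4ℚ 8ℚ : ℚ
2ℚ = ι (ℤ.+ 2)
3ℚ = ι (ℤ.+ 3)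
4ℚ = ι (ℤ.+ 4)
8ℚ = ι (ℤ.+ 8)

-- division; only ever used with a nonzero denominator (the 0 branch is a dummy)
_⊘_ : ℚ → ℚ → ℚ
p ⊘ q with q ≟ 0ℚ
... | yes _ = 0ℚ
... | no q≢0 = _÷_ p q {{≢-nonZero q≢0}}

data Pt : Set where
  ∞   : Pt
  aff : ℚ → ℚ → Pt

OnCurve : ℚ → ℚ → Pt → Set
OnCurve A C ∞ = ⊤
OnCurve A C (aff x y) = y * y ≡ x * x * x + A * x - C * C * C - A * C

-- the usual chord-tangent group law on E_{A,C} (only A enters the formulas)
neg : Pt → Pt
neg ∞ = ∞
neg (aff x y) = aff x (- y)

third : ℚ → ℚ → ℚ → ℚ → ℚ → Pt
third l x₁ y₁ x₂ _ = let x₃ = l * l - x₁ - x₂ in aff x₃ (l * (x₁ - x₃) - y₁)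

add : ℚ → Pt → Pt → Pt
add A ∞ Q = Q
add A (aff x₁ y₁) ∞ = aff x₁ y₁
add A (aff x₁ y₁) (aff x₂ y₂) with x₁ ≟ x₂
... | no _ = third ((y₂ - y₁) ⊘ (x₂ - x₁)) x₁ y₁ x₂ y₂
... | yes _ with y₁ + y₂ ≟ 0ℚ
...   | yes _ = ∞
...   | no _ = third ((3ℚ * x₁ * x₁ + A) ⊘ (2ℚ * y₁)) x₁ y₁ x₂ y₂

ã c̃ : ℤ → ℤ → ℚ
ã a c = ι (ℤ.- (ℤ.+ 4 ℤ.* a) ℤ.- ℤ.+ 15 ℤ.* c ℤ.* c)
c̃ a c = ι (ℤ.- (ℤ.+ 2 ℤ.* c))

E Ẽ : ℤ → ℤ → Pt → Set
E a c = OnCurve (ι a) (ι c)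
Ẽ a c = OnCurve (ã a c) (c̃ a c)

ψ : ℤ → ℤ → Pt → Pt
ψ a c ∞ = ∞
ψ a c (aff x y) with x ≟ ι c
... | yes _ = ∞
... | no _ =
  let A = ι a ; C = ι c in
  aff ((x * x - x * C + A + 3ℚ * C * C) ⊘ (x - C))
      ((y * (x * x - 2ℚ * x * C - A - 2ℚ * C * C)) ⊘ ((x - C) * (x - C)))

ψ̃ : ℤ → ℤ → Pt → Pt
ψ̃ a c ∞ = ∞
ψ̃ a c (aff x y) with x ≟ c̃ a c
... | yes _ = ∞
... | no _ =
  let A = ã a c ; C = c̃ a c in
  aff ((x * x - x * C + A + 3ℚ * C * C) ⊘ (4ℚ * (x - C)))
      ((y * (x * x - 2ℚ * x * C - A - 2ℚ * C * C)) ⊘ (8ℚ * (x - C) * (x - C)))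

Kerψ̃ : ℤ → ℤ → Pt → Set
Kerψ̃ a c P = Ẽ a c P × ψ̃ a c P ≡ ∞

Imψ : ℤ → ℤ → Pt → Set
Imψ a c P = ∃ λ Q → E a c Q × ψ a c Q ≡ P

-- Index A T S n :  the subgroup S of the subgroup T (of a curve group with
-- coefficient A) has index [T : S] = n, i.e. there are exactly n cosets of S in T:
-- n representatives in T, pairwise in distinct cosets, covering T.
Index : ℚ → (Pt → Set) → (Pt → Set) → ℕ → Set
Index A T S n = Σ (Fin n → Pt) λ r →
    ((i : Fin n) → T (r i))
  × ((i j : Fin n) → S (add A (neg (r i)) (r j)) → i ≡ j)
  × ((t : Pt) → T t → Σ (Fin n) λ i → S (add A (neg (r i)) t))

-- Lemma 7.1.  Write P̃₀ = (c̃, 0) for the rational 2-torsion point of Ẽ that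
-- generates the kernel of ψ̃, and S = ker ψ̃ ∩ ψ(E(ℚ)).  The proof has three parts.
--
-- (1) Group theory.  If a subgroup T = {∞, K} of a curve group has order 2 and
--     S ⊆ T contains ∞, then [T : S] = 1 exactly when K ∈ S, and [T : S] = 2
--     when K ∉ S (module TwoElementSubgroup).
-- (2) ker ψ̃ = {∞, P̃₀}: ψ̃ sends every finite point with x ≠ c̃ to a finite point,
--     and the only point of a curve E_{A,C} with abscissa C is (C, 0).
-- (3) P̃₀ ∈ ψ(E(ℚ)) iff E has a rational point (x, 0) with x ≠ c.  The cubic of
--     E factors as (x - c)·q(x), q(x) = x² + cx + c² + a, and for x ≠ c the
--     abscissa of ψ(x, y) equals c̃ = -2c exactly when q(x) = 0.
--
-- The theorem is (1) applied to T = ker ψ̃ and K = P̃₀, using (2) and (3).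
module Submission where

open import Defs
open import Data.Integer using (ℤ; +_; -_; _*_)
open import Data.Rational using (ℚ; 0ℚ)
open import Data.Product using (Σ; _×_; ∃)
open import Relation.Nullary using (¬_)
open import Relation.Binary.PropositionalEquality using (_≡_; _≢_)
open import Function.Bundles using (_⇔_)

import Data.Integer as ℤ
open import Data.Nat using (suc)
open import Data.Nat.Divisibility using (∣1⇒≡1)
open import Data.Nat.Coprimality using (Coprime)
open import Data.Fin using (Fin; zero; suc)
open import Data.Unit using (tt)
open import Data.Sum using (_⊎_; inj₁; inj₂; [_,_])
open import Data.Product using (_,_; proj₂)
open import Function using (id; _∘_)
open import Function.Bundles using (mk⇔; Equivalence)
open import Function.Construct.Composition using (_⇔-∘_)
open import Relation.Nullary using (yes; no; contradiction)
open import Relation.Binary.PropositionalEquality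
  using (refl; sym; trans; cong; cong₂; subst; module ≡-Reasoning)
open import Data.Rational using (mkℚ; 1ℚ; 1/_; ≢-nonZero)
  renaming (_+_ to _+q_; _*_ to _*q_; _-_ to _-q_; -_ to -q_)
import Data.Rational.Properties as ℚ
open import Data.Rational.Properties using (_≟_)
open import Algebra.Properties.AbelianGroup ℚ.+-0-abelianGroup
  using (identityˡ-unique; x∙y⁻¹≈ε⇒x≈y)
open import Data.Rational.Solver using (module +-*-Solver)
open +-*-Solver using (solve; _:=_; _:+_; _:*_; _:-_; :-_; con)

open Equivalence using (to; from)

-- Part (1): the index of a subgroup inside a subgroup of order 2.

add-identityʳ : ∀ A P → add A P ∞ ≡ P
add-identityʳ A ∞ = refl
add-identityʳ A (aff x y) = refl

add-self-two-torsion : ∀ A x → add A (aff x 0ℚ) (aff x 0ℚ) ≡ ∞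
add-self-two-torsion A x with x ≟ x
... | yes _ = refl
... | no x≢x = contradiction refl x≢x

module TwoElementSubgroup
    (A : ℚ) (T S : Pt → Set) (K : Pt)
    (T-elements : ∀ t → T t → t ≡ ∞ ⊎ t ≡ K)
    (T∋∞ : T ∞) (T∋K : T K) (S∋∞ : S ∞)
    (K⁻¹≡K : neg K ≡ K) (K+K≡∞ : add A K K ≡ ∞)
  where

  S-K+∞⇒S-K : S (add A (neg K) ∞) → S K
  S-K+∞⇒S-K = subst S (trans (add-identityʳ A (neg K)) K⁻¹≡K)

  S-K+K : S (add A (neg K) K)
  S-K+K = subst S (sym (trans (cong (λ P → add A P K) K⁻¹≡K) K+K≡∞)) S∋∞

  index1⇔ : Index A T S 1 ⇔ S K
  index1⇔ = mk⇔ index1⇒ ⇒index1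
    where
    index1⇒ : Index A T S 1 → S K
    index1⇒ (r , T∋r , _ , cover) with T-elements (r zero) (T∋r zero)
    ... | inj₁ r≡∞ with cover K T∋K
    ...   | zero , s = subst (λ P → S (add A (neg P) K)) r≡∞ s
    index1⇒ (r , T∋r , _ , cover) | inj₂ r≡K with cover ∞ T∋∞
    ...   | zero , s = S-K+∞⇒S-K (subst (λ P → S (add A (neg P) ∞)) r≡K s)

    ⇒index1 : S K → Index A T S 1
    ⇒index1 S∋K = (λ _ → ∞) , (λ _ → T∋∞) , (λ { zero zero _ → refl }) , cover
      where
      cover : ∀ t → T t → Σ (Fin 1) λ _ → S t
      cover t T∋t with T-elements t T∋t
      ... | inj₁ refl = zero , S∋∞
      ... | inj₂ refl = zero , S∋K

  index2 : ¬ S K → Index A T S 2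
  index2 K∉S = r , T∋r , distinct , cover
    where
    r : Fin 2 → Pt
    r zero = ∞
    r (suc _) = K

    T∋r : ∀ i → T (r i)
    T∋r zero = T∋∞
    T∋r (suc _) = T∋K

    distinct : ∀ i j → S (add A (neg (r i)) (r j)) → i ≡ j
    distinct zero zero _ = refl
    distinct zero (suc zero) s = contradiction s K∉S
    distinct (suc zero) zero s = contradiction (S-K+∞⇒S-K s) K∉S
    distinct (suc zero) (suc zero) _ = refl

    cover : ∀ t → T t → Σ (Fin 2) λ i → S (add A (neg (r i)) t)
    cover t T∋t with T-elements t T∋t
    ... | inj₁ refl = zero , S∋∞
    ... | inj₂ refl = suc zero , S-K+K

⊘-spec : ∀ {p q r} → q ≢ 0ℚ → (p ⊘ q ≡ r) ⇔ (p ≡ r *q q)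
⊘-spec {p} {q} {r} q≢0 with q ≟ 0ℚ
... | yes q≡0 = contradiction q≡0 q≢0
... | no q≢0′ = mk⇔ quotient⇒ ⇒quotient
  where
  instance _ = ≢-nonZero q≢0′
  open ≡-Reasoning

  quotient⇒ : p *q (1/ q) ≡ r → p ≡ r *q q
  quotient⇒ eq = begin
    p                   ≡⟨ sym (ℚ.*-identityʳ p) ⟩
    p *q 1ℚ             ≡⟨ cong (p *q_) (sym (ℚ.*-inverseˡ q)) ⟩
    p *q ((1/ q) *q q)  ≡⟨ sym (ℚ.*-assoc p (1/ q) q) ⟩
    p *q (1/ q) *q q    ≡⟨ cong (_*q q) eq ⟩
    r *q q              ∎

  ⇒quotient : p ≡ r *q q → p *q (1/ q) ≡ r
  ⇒quotient refl = begin
    r *q q *q (1/ q)    ≡⟨ ℚ.*-assoc r q (1/ q) ⟩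
    r *q (q *q (1/ q))  ≡⟨ cong (r *q_) (ℚ.*-inverseʳ q) ⟩
    r *q 1ℚ             ≡⟨ ℚ.*-identityʳ r ⟩
    r                   ∎

zero-product : ∀ p q → p *q q ≡ 0ℚ → p ≡ 0ℚ ⊎ q ≡ 0ℚ
zero-product p q pq≡0 with p ≟ 0ℚ
... | yes p≡0 = inj₁ p≡0
... | no p≢0 = inj₂ (begin
    q                   ≡⟨ sym (ℚ.*-identityˡ q) ⟩
    1ℚ *q q             ≡⟨ cong (_*q q) (sym (ℚ.*-inverseˡ p)) ⟩
    (1/ p) *q p *q q    ≡⟨ ℚ.*-assoc (1/ p) p q ⟩
    (1/ p) *q (p *q q)  ≡⟨ cong ((1/ p) *q_) pq≡0 ⟩
    (1/ p) *q 0ℚ        ≡⟨ ℚ.*-zeroʳ (1/ p) ⟩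
    0ℚ                  ∎)
  where
  instance _ = ≢-nonZero p≢0
  open ≡-Reasoning

cancel-nonzero : ∀ {p q} → p ≢ 0ℚ → p *q q ≡ 0ℚ → q ≡ 0ℚ
cancel-nonzero {p} {q} p≢0 pq≡0 = [ (λ p≡0 → contradiction p≡0 p≢0) , id ] (zero-product p q pq≡0)

square≡0 : ∀ y → y *q y ≡ 0ℚ → y ≡ 0ℚ
square≡0 y yy≡0 = [ id , id ] (zero-product y y yy≡0)

difference≢0 : ∀ {x y} → x ≢ y → x -q y ≢ 0ℚ
difference≢0 {x} {y} x≢y x-y≡0 = x≢y (x∙y⁻¹≈ε⇒x≈y x y x-y≡0)

coprime-to-1 : ∀ n → Coprime n 1
coprime-to-1 n (_ , d∣1) = ∣1⇒≡1 d∣1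

ι-mkℚ : ∀ z → ι z ≡ mkℚ z 0 (coprime-to-1 ℤ.∣ z ∣)
ι-mkℚ (+ n) = ℚ.normalize-coprime (coprime-to-1 n)
ι-mkℚ ℤ.-[1+ n ] = cong -q_ (ℚ.normalize-coprime (coprime-to-1 (suc n)))

ι-neg : ∀ z → ι (ℤ.- z) ≡ -q (ι z)
ι-neg z rewrite ι-mkℚ z | ι-mkℚ (ℤ.- z) = mkℚ-neg z
  where
  mkℚ-neg : ∀ z → mkℚ (ℤ.- z) 0 (coprime-to-1 ℤ.∣ ℤ.- z ∣) ≡ -q (mkℚ z 0 (coprime-to-1 ℤ.∣ z ∣))
  mkℚ-neg (+ 0) = refl
  mkℚ-neg (+ suc n) = refl
  mkℚ-neg ℤ.-[1+ n ] = refl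

c̃≡-2c : ∀ a c → c̃ a c ≡ -q (2ℚ *q ι c)
c̃≡-2c a c = trans (ι-neg (+ 2 * c)) (cong -q_ ι[2c]≡2ι[c])
  where
  -- once ι c is in lowest terms, the product 2 · ι c normalises to ι (2c)
  ι[2c]≡2ι[c] : ι (+ 2 * c) ≡ 2ℚ *q ι c
  ι[2c]≡2ι[c] = cong (2ℚ *q_) (sym (ι-mkℚ c))

quad : ℚ → ℚ → ℚ → ℚ
quad A C x = x *q x +q x *q C +q C *q C +q A

cubic-factor : ∀ A C x → x *q x *q x +q A *q x -q C *q C *q C -q A *q C ≡ (x -q C) *q quad A C x
cubic-factor A C x = solve 3 (λ A C x →
  x :* x :* x :+ A :* x :- C :* C :* C :- A :* C := (x :- C) :* (x :* x :+ x :* C :+ C :* C :+ A)) refl A C x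

two-torsion⇔ : ∀ A C {x} → x ≢ C → OnCurve A C (aff x 0ℚ) ⇔ quad A C x ≡ 0ℚ
two-torsion⇔ A C {x} x≢C = mk⇔
  (λ on-curve → cancel-nonzero (difference≢0 x≢C) (trans (sym (cubic-factor A C x)) (sym on-curve)))
  (λ q≡0 → sym (begin
    x *q x *q x +q A *q x -q C *q C *q C -q A *q C  ≡⟨ cubic-factor A C x ⟩
    (x -q C) *q quad A C x                           ≡⟨ cong ((x -q C) *q_) q≡0 ⟩
    (x -q C) *q 0ℚ                                   ≡⟨ ℚ.*-zeroʳ (x -q C) ⟩
    0ℚ                                               ∎))
  where open ≡-Reasoning

cubic-at-C : ∀ A C → C *q C *q C +q A *q C -q C *q C *q C -q A *q C ≡ 0ℚ
cubic-at-C = solve 2 (λ A C → C :* C :* C :+ A :* C :- C :* C :* C :- A :* C := con 0ℚ) refl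

ordinate-above-C : ∀ A C {y} → OnCurve A C (aff C y) → y ≡ 0ℚ
ordinate-above-C A C {y} on-curve = square≡0 y (trans on-curve (cubic-at-C A C))

ψ-numerator : ℚ → ℚ → ℚ → ℚ
ψ-numerator A C x = x *q x -q x *q C +q A +q 3ℚ *q C *q C

ψ-numerator-split : ∀ A C x → ψ-numerator A C x ≡ quad A C x +q (-q (2ℚ *q C)) *q (x -q C)
ψ-numerator-split A C x = solve 3 (λ A C x →
  x :* x :- x :* C :+ A :+ con 3ℚ :* C :* C
    := (x :* x :+ x :* C :+ C :* C :+ A) :+ (:- (con 2ℚ :* C)) :* (x :- C)) refl A C x

ψ-abscissa⇔ : ∀ A C {x} → x ≢ C →
  (ψ-numerator A C x ⊘ (x -q C) ≡ -q (2ℚ *q C)) ⇔ quad A C x ≡ 0ℚ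
ψ-abscissa⇔ A C {x} x≢C = mk⇔
  (λ abscissa≡ → identityˡ-unique (quad A C x) slope
     (trans (sym (ψ-numerator-split A C x)) (to (⊘-spec (difference≢0 x≢C)) abscissa≡)))
  (λ q≡0 → from (⊘-spec (difference≢0 x≢C))
     (trans (ψ-numerator-split A C x) (trans (cong (_+q slope) q≡0) (ℚ.+-identityˡ slope))))
  where
  slope : ℚ
  slope = (-q (2ℚ *q C)) *q (x -q C)

ψ-ordinate-factor : ℚ → ℚ → ℚ → ℚ
ψ-ordinate-factor A C x = x *q x -q 2ℚ *q x *q C -q A -q 2ℚ *q C *q C

-- Parts (2) and (3): the kernel of ψ̃ and the ψ-preimage of its generator.

P̃₀ : ℤ → ℤ → Pt
P̃₀ a c = aff (c̃ a c) 0ℚ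

OtherTwoTorsion : ℤ → ℤ → Set
OtherTwoTorsion a c = ∃ λ (x : ℚ) → E a c (aff x 0ℚ) × x ≢ ι c

-- The x-coordinate of a finite point (∞ gets a dummy value).
abscissa : Pt → ℚ
abscissa ∞ = 0ℚ
abscissa (aff x _) = x

P̃₀∈kerψ̃ : ∀ a c → Kerψ̃ a c (P̃₀ a c)
P̃₀∈kerψ̃ a c = sym (cubic-at-C (ã a c) (c̃ a c)) , ψ̃[P̃₀]≡∞
  where
  ψ̃[P̃₀]≡∞ : ψ̃ a c (P̃₀ a c) ≡ ∞
  ψ̃[P̃₀]≡∞ with c̃ a c ≟ c̃ a c
  ... | yes _ = refl
  ... | no c̃≢c̃ = contradiction refl c̃≢c̃

-- ker ψ̃ = {∞, P̃₀}: points with x ≠ c̃ have finite image, and x = c̃ forces y = 0.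
kerψ̃-elements : ∀ a c t → Kerψ̃ a c t → t ≡ ∞ ⊎ t ≡ P̃₀ a c
kerψ̃-elements a c ∞ _ = inj₁ refl
kerψ̃-elements a c (aff x y) (on-curve , ψ̃[t]≡∞) with x ≟ c̃ a c
... | no _ with () ← ψ̃[t]≡∞
... | yes refl = inj₂ (cong (aff x) (ordinate-above-C (ã a c) x on-curve))

Imψ∋P̃₀⇔ : ∀ a c → Imψ a c (P̃₀ a c) ⇔ OtherTwoTorsion a c
Imψ∋P̃₀⇔ a c = mk⇔ preimage⇒ ⇒preimage
  where
  preimage⇒ : Imψ a c (P̃₀ a c) → OtherTwoTorsion a c
  preimage⇒ (∞ , _ , ())
  preimage⇒ (aff x y , _ , ψ[Q]≡P̃₀) with x ≟ ι c
  ... | yes _ with () ← ψ[Q]≡P̃₀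
  ... | no x≢c = x , from (two-torsion⇔ (ι a) (ι c) x≢c) q≡0 , x≢c
    where
    q≡0 : quad (ι a) (ι c) x ≡ 0ℚ
    q≡0 = to (ψ-abscissa⇔ (ι a) (ι c) x≢c) (trans (cong abscissa ψ[Q]≡P̃₀) (c̃≡-2c a c))

  ⇒preimage : OtherTwoTorsion a c → Imψ a c (P̃₀ a c)
  ⇒preimage (x , on-curve , x≢c) = aff x 0ℚ , on-curve , ψ[x,0]≡P̃₀
    where
    ψ[x,0]≡P̃₀ : ψ a c (aff x 0ℚ) ≡ P̃₀ a c
    ψ[x,0]≡P̃₀ with x ≟ ι c
    ... | yes x≡c = contradiction x≡c x≢c
    -- the abscissa is c̃ because x is a root of q, the ordinate 0 because y = 0
    ... | no _ = cong₂ aff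
      (trans (from (ψ-abscissa⇔ (ι a) (ι c) x≢c) (to (two-torsion⇔ (ι a) (ι c) x≢c) on-curve))
             (sym (c̃≡-2c a c)))
      (from (⊘-spec (difference≢0 x≢c ∘ square≡0 (x -q ι c)))
        (trans (ℚ.*-zeroˡ (ψ-ordinate-factor (ι a) (ι c) x))
               (sym (ℚ.*-zeroˡ ((x -q ι c) *q (x -q ι c))))))

lemma7p1 : (a c : ℤ) → a ≢ - (+ 3 * c * c) → + 4 * a ≢ - (+ 3 * c * c) →
  (Index (ã a c) (Kerψ̃ a c) (λ P → Kerψ̃ a c P × Imψ a c P) 1
     ⇔ (∃ λ (x : ℚ) → E a c (aff x 0ℚ) × x ≢ ι c))
  × (¬ (∃ λ (x : ℚ) → E a c (aff x 0ℚ) × x ≢ ι c)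
     → Index (ã a c) (Kerψ̃ a c) (λ P → Kerψ̃ a c P × Imψ a c P) 2)
lemma7p1 a c _ _ = P̃₀∈S⇔ ⇔-∘ index1⇔ , λ none → index2 (none ∘ to P̃₀∈S⇔)
  where
  open TwoElementSubgroup (ã a c) (Kerψ̃ a c) (λ P → Kerψ̃ a c P × Imψ a c P) (P̃₀ a c)
    (kerψ̃-elements a c) (tt , refl) (P̃₀∈kerψ̃ a c) ((tt , refl) , ∞ , tt , refl)
    refl (add-self-two-torsion (ã a c) (c̃ a c))

  -- P̃₀ ∈ ker ψ̃ always, so P̃₀ ∈ S is the statement about ψ(E(ℚ)) alone
  P̃₀∈S⇔ : (Kerψ̃ a c (P̃₀ a c) × Imψ a c (P̃₀ a c)) ⇔ OtherTwoTorsion a c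
  P̃₀∈S⇔ = mk⇔ (to (Imψ∋P̃₀⇔ a c) ∘ proj₂) (λ other → P̃₀∈kerψ̃ a c , from (Imψ∋P̃₀⇔ a c) other)
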